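{- Let $m,n,p,q$ be nonnegative integers with $p\ge mn$ and $q\ge 1$. Then there is a bijection between $\Gamma_{p+q+mn,n}^{(p)}$ and $\Gamma_{p+q+mn,n}^{(p+1)}$; in particular these two sets have the same cardinality.
   Context: Let $\Gamma=\{a,b\}$ be a two-letter alphabet graded by $\|a\|=1$ and $\|b\|=m+1$. For a word $w=w_1\cdots w_\ell\in\Gamma^*$ its weight is $\|w\|=\|w_1\|+\cdots+\|w_\ell\|$ (the empty word has weight $0$), and $|w|_b$ is the number of letters of $w$ equal to $b$. For integers $P,k$ let $\Gamma_{P,k}=\{w\in\Gamma^*:\ \|w\|=P,\ |w|_b=k\}$. For an integer $r$, let $\Gamma_{P,k}^{(r)}$ be the set of words $w\in\Gamma_{P,k}$ that have a prefix (a word $w_1\cdots w_i$, $0\le i\le\ell$) of weight exactly $r$. -}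

module Defs where

open import Data.Nat using (ℕ; suc; _+_)
open import Data.List using (List; []; _∷_; _++_)
open import Data.Product using (Σ; ∃; _×_)
open import Relation.Binary.PropositionalEquality using (_≡_)

data Letter : Set where
  a b : Letter

letterWeight : ℕ → Letter → ℕ
letterWeight m a = 1
letterWeight m b = suc m

weight : ℕ → List Letter → ℕ
weight m []       = 0
weight m (x ∷ w)  = letterWeight m x + weight m w

countB : List Letter → ℕ
countB []       = 0
countB (a ∷ w)  = countB w
countB (b ∷ w)  = suc (countB w)

HasPrefixOfWeight : ℕ → ℕ → List Letter → Set
HasPrefixOfWeight m r w = ∃ λ u → ∃ λ v → (w ≡ u ++ v) × (weight m u ≡ r)

-- Γ_{P,k}^{(r)} (for grading parameter m), as a subtype of words
Γ⁽_⁾ : ℕ → ℕ → ℕ → ℕ → Set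
Γ⁽ r ⁾ m P k = Σ (List Letter) λ w → (weight m w ≡ P) × (countB w ≡ k) × HasPrefixOfWeight m r w

-- Words over Γ = {a, b} with ‖a‖ = 1, ‖b‖ = m + 1.  Put W = r + s + 1 and let
-- c be the number of b's, with m·c ≤ r and m·c ≤ s.  We exhibit an explicit
-- INVOLUTION  exchange  of the words of weight W with c letters b that maps
-- the words split as (r | s+1) onto those split as (r+1 | s), and back.
--
-- It is built greedily: while m·c < r the first letter is kept and the problem
-- recurses on the rest (with r lowered by the letter's weight); if instead
-- m·c < s, the same is done on the reversed word; when r = s = m·c the word is
-- simply reversed, which swaps the splits (r | r+1) and (r+1 | r).  Which of
-- the three moves is taken depends only on (m·c, r, s), never on the word, so
-- applying the map twice undoes it: the map is an involution of all words.
module Submission where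

open import Defs
open import Data.Nat using (ℕ; zero; suc; _+_; _*_; _∸_; _≤_; _<_; s≤s; _<?_)
open import Data.Nat.Properties
  using (+-assoc; +-suc; +-comm; +-cancelˡ-≡; m+n∸m≡n; m+1+n≢0; m≤m+n; m≤n+m; n≤1+n; ≤-refl; ≤-trans;
         ≤-antisym; ≮⇒≥; *-suc; *-monoʳ-≤; m≤n⇒∃[o]m+o≡n)
open import Data.Nat.ListAction using (sum)
open import Data.Nat.ListAction.Properties using (sum-++; sum-↭)
open import Data.List using (List; []; _∷_; _++_; map; reverse)
open import Data.List.Properties using (map-++; reverse-map; reverse-++; reverse-involutive; ∷-injective; ++-cancelˡ)
open import Data.List.Relation.Binary.Permutation.Propositional.Properties using (↭-reverse)
open import Data.Product using (∃-syntax; _×_; _,_; proj₁; proj₂)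
open import Data.Empty using (⊥-elim)
open import Relation.Nullary using (yes; no)
open import Relation.Binary.PropositionalEquality using (_≡_; refl; sym; trans; cong; cong₂; subst; module ≡-Reasoning)
open import Function.Bundles using (_⤖_; mk↔ₛ′)
open import Function.Properties.Inverse using (↔⇒⤖)

-- The total of a letter valuation f over a word.  Weight and b-count are both
-- such totals, so their behaviour under ++ and reverse is proved once here.
module Total {A : Set} (f : A → ℕ) where

  total : List A → ℕ
  total w = sum (map f w)

  total-++ : ∀ u v → total (u ++ v) ≡ total u + total v
  total-++ u v = trans (cong sum (map-++ f u v)) (sum-++ (map f u) (map f v))

  total-reverse : ∀ w → total (reverse w) ≡ total w
  total-reverse w = trans (cong sum (reverse-map f w)) (sum-↭ (↭-reverse (map f w)))

isB : Letter → ℕ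
isB a = 0
isB b = 1

countB-total : ∀ w → countB w ≡ Total.total isB w
countB-total []      = refl
countB-total (a ∷ w) = countB-total w
countB-total (b ∷ w) = cong suc (countB-total w)

countB-reverse : ∀ w → countB (reverse w) ≡ countB w
countB-reverse w = begin
  countB (reverse w)           ≡⟨ countB-total (reverse w) ⟩
  total (reverse w)            ≡⟨ total-reverse w ⟩
  total w                      ≡⟨ sym (countB-total w) ⟩
  countB w                     ∎
  where open ≡-Reasoning
        open Total isB using (total; total-reverse)

countB-tail : ∀ x w → countB w ≤ countB (x ∷ w)
countB-tail a w = ≤-refl
countB-tail b w = n≤1+n (countB w)

module Exchange (m : ℕ) where

  ‖_‖ : Letter → ℕ
  ‖ x ‖ = letterWeight m x

  weight-total : ∀ w → weight m w ≡ Total.total ‖_‖ w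
  weight-total []      = refl
  weight-total (x ∷ w) = cong (‖ x ‖ +_) (weight-total w)

  weight-++ : ∀ u v → weight m (u ++ v) ≡ weight m u + weight m v
  weight-++ u v = begin
    weight m (u ++ v)                 ≡⟨ weight-total (u ++ v) ⟩
    total (u ++ v)                    ≡⟨ total-++ u v ⟩
    total u + total v                 ≡⟨ sym (cong₂ _+_ (weight-total u) (weight-total v)) ⟩
    weight m u + weight m v           ∎
    where open ≡-Reasoning
          open Total ‖_‖ using (total; total-++)

  weight-reverse : ∀ w → weight m (reverse w) ≡ weight m w
  weight-reverse w = begin
    weight m (reverse w)   ≡⟨ weight-total (reverse w) ⟩
    total (reverse w)      ≡⟨ total-reverse w ⟩
    total w                ≡⟨ sym (weight-total w) ⟩
    weight m w             ∎
    where open ≡-Reasoning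
          open Total ‖_‖ using (total; total-reverse)

  Split : ℕ → ℕ → List Letter → Set
  Split r t w = ∃[ u ] ∃[ v ] (w ≡ u ++ v) × (weight m u ≡ r) × (weight m v ≡ t)

  split-weight : ∀ {r t w} → Split r t w → weight m w ≡ r + t
  split-weight (u , v , refl , refl , refl) = weight-++ u v

  split-reverse : ∀ {r t w} → Split r t w → Split t r (reverse w)
  split-reverse (u , v , refl , refl , refl) =
    reverse v , reverse u , reverse-++ u v , weight-reverse v , weight-reverse u

  split-cons : ∀ {r t w} x → Split r t w → Split (‖ x ‖ + r) t (x ∷ w)
  split-cons x (u , v , refl , refl , refl) = x ∷ u , v , refl , refl , refl

  -- Conversely a split of x ∷ w beyond the first letter is a split of w;
  -- the empty prefix is excluded because every letter has positive weight.
  split-uncons : ∀ {r t w} x → Split (‖ x ‖ + r) t (x ∷ w) → Split r t w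
  split-uncons a ([] , _ , _ , () , _)
  split-uncons b ([] , _ , _ , () , _)
  split-uncons x (y ∷ u , v , e , wu , wv) with ∷-injective e
  ... | refl , refl = u , v , refl , +-cancelˡ-≡ ‖ x ‖ _ _ wu , wv

  prefix⇒split : ∀ {r t w} → HasPrefixOfWeight m r w → weight m w ≡ r + t → Split r t w
  prefix⇒split (u , v , refl , refl) e = u , v , refl , refl , +-cancelˡ-≡ (weight m u) _ _ (trans (sym (weight-++ u v)) e)

  split⇒prefix : ∀ {r t w} → Split r t w → HasPrefixOfWeight m r w
  split⇒prefix (u , v , e , wu , _) = u , v , e , wu

  -- Prefixes are determined by their weight, since letters have positive weight.
  prefix-unique : ∀ u u' {v v'} → u ++ v ≡ u' ++ v' → weight m u ≡ weight m u' → u ≡ u'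
  prefix-unique []      []       e h  = refl
  prefix-unique []      (a ∷ u') e ()
  prefix-unique []      (b ∷ u') e ()
  prefix-unique (a ∷ u) []       e ()
  prefix-unique (b ∷ u) []       e ()
  prefix-unique (x ∷ u) (y ∷ u') e h with ∷-injective e
  ... | refl , e' = cong (x ∷_) (prefix-unique u u' e' (+-cancelˡ-≡ ‖ x ‖ _ _ h))

  prefix-irrelevant : ∀ {r w} (h h' : HasPrefixOfWeight m r w) → h ≡ h'
  prefix-irrelevant (u , v , refl , refl) (u' , v' , e' , h') with prefix-unique u u' e' (sym h')
  ... | refl with ++-cancelˡ u v v' e'
  prefix-irrelevant (u , v , refl , refl) (u , v , refl , refl) | refl | refl = refl

  -- The three moves of the involution, chosen from (m·c, r, s) alone.
  data Move : Set where
    keep-first keep-last reflect : Move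

  choose : ℕ → ℕ → ℕ → Move
  choose c r s with c <? r | c <? s
  ... | yes _ | _     = keep-first
  ... | no _  | yes _ = keep-last
  ... | no _  | no _  = reflect

  -- exchange k r s w, with fuel k (any k > r + s suffices for the splits we track).
  mutual
    exchange : ℕ → ℕ → ℕ → List Letter → List Letter
    exchange zero    r s w = w
    exchange (suc k) r s w = perform k r s w (choose (m * countB w) r s)

    perform : ℕ → ℕ → ℕ → List Letter → Move → List Letter
    perform k r s w keep-first = peel k r s w
    perform k r s w keep-last  = reverse (peel k s r (reverse w))
    perform k r s w reflect    = reverse w

    peel : ℕ → ℕ → ℕ → List Letter → List Letter
    peel k r s []      = []
    peel k r s (x ∷ w) = x ∷ exchange k (r ∸ ‖ x ‖) s w

  peel-∷ : ∀ k r s x w → peel k (‖ x ‖ + r) s (x ∷ w) ≡ x ∷ exchange k r s w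
  peel-∷ k r s x w = cong (λ r' → x ∷ exchange k r' s w) (m+n∸m≡n ‖ x ‖ r)

  -- The b-count is preserved; this is what makes the choice of move repeatable.
  mutual
    countB-exchange : ∀ k r s w → countB (exchange k r s w) ≡ countB w
    countB-exchange zero    r s w = refl
    countB-exchange (suc k) r s w = countB-perform k r s w (choose (m * countB w) r s)

    countB-perform : ∀ k r s w d → countB (perform k r s w d) ≡ countB w
    countB-perform k r s w keep-first = countB-peel k r s w
    countB-perform k r s w keep-last  = begin
      countB (reverse (peel k s r (reverse w)))   ≡⟨ countB-reverse (peel k s r (reverse w)) ⟩
      countB (peel k s r (reverse w))             ≡⟨ countB-peel k s r (reverse w) ⟩
      countB (reverse w)                          ≡⟨ countB-reverse w ⟩
      countB w                                    ∎
      where open ≡-Reasoning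
    countB-perform k r s w reflect    = countB-reverse w

    countB-peel : ∀ k r s w → countB (peel k r s w) ≡ countB w
    countB-peel k r s []      = refl
    countB-peel k r s (a ∷ w) = countB-exchange k (r ∸ 1) s w
    countB-peel k r s (b ∷ w) = cong suc (countB-exchange k (r ∸ suc m) s w)

  mutual
    exchange-involutive : ∀ k r s w → exchange k r s (exchange k r s w) ≡ w
    exchange-involutive zero    r s w = refl
    exchange-involutive (suc k) r s w = begin
      perform k r s w′ (choose (m * countB w′) r s)
        ≡⟨ cong (λ c → perform k r s w′ (choose (m * c) r s)) (countB-perform k r s w d) ⟩
      perform k r s w′ d
        ≡⟨ perform-involutive k r s w d ⟩
      w ∎
      where open ≡-Reasoning
            d  = choose (m * countB w) r s
            w′ = perform k r s w d

    perform-involutive : ∀ k r s w d → perform k r s (perform k r s w d) d ≡ w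
    perform-involutive k r s w keep-first = peel-involutive k r s w
    perform-involutive k r s w keep-last  = begin
      reverse (peel k s r (reverse (reverse (peel k s r (reverse w)))))
        ≡⟨ cong (λ v → reverse (peel k s r v)) (reverse-involutive (peel k s r (reverse w))) ⟩
      reverse (peel k s r (peel k s r (reverse w)))
        ≡⟨ cong reverse (peel-involutive k s r (reverse w)) ⟩
      reverse (reverse w)
        ≡⟨ reverse-involutive w ⟩
      w ∎
      where open ≡-Reasoning
    perform-involutive k r s w reflect    = reverse-involutive w

    peel-involutive : ∀ k r s w → peel k r s (peel k r s w) ≡ w
    peel-involutive k r s []      = refl
    peel-involutive k r s (x ∷ w) = cong (x ∷_) (exchange-involutive k (r ∸ ‖ x ‖) s w)

  Transfer : ℕ → ℕ → List Letter → List Letter → Set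
  Transfer r s w w' = (Split r (suc s) w → Split (suc r) s w') × (Split (suc r) s w → Split r (suc s) w')

  transfer-reverse : ∀ {r s w w'} → Transfer s r (reverse w) w' → Transfer r s w (reverse w')
  transfer-reverse (fwd , bwd) =
    (λ sp → split-reverse (bwd (split-reverse sp))) , (λ sp → split-reverse (fwd (split-reverse sp)))

  transfer-reflect : ∀ {r s} w → r ≡ s → Transfer r s w (reverse w)
  transfer-reflect w refl = split-reverse , split-reverse

  transfer-cons : ∀ {r s w w'} x → Transfer r s w w' → Transfer (‖ x ‖ + r) s (x ∷ w) (x ∷ w')
  transfer-cons {r} {s} {w} {w'} x (fwd , bwd) = forward , backward
    where
    forward : Split (‖ x ‖ + r) (suc s) (x ∷ w) → Split (suc (‖ x ‖ + r)) s (x ∷ w')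
    forward sp = subst (λ r′ → Split r′ s (x ∷ w')) (+-suc ‖ x ‖ r) (split-cons x (fwd (split-uncons x sp)))
    backward : Split (suc (‖ x ‖ + r)) s (x ∷ w) → Split (‖ x ‖ + r) (suc s) (x ∷ w')
    backward sp = split-cons x (bwd (split-uncons x (subst (λ r′ → Split r′ s (x ∷ w)) (sym (+-suc ‖ x ‖ r)) sp)))

  front-bound : ∀ x w r → m * countB (x ∷ w) < r → ∃[ r₀ ] (r ≡ ‖ x ‖ + r₀) × (m * countB w ≤ r₀)
  front-bound a w (suc r₀) (s≤s h) = r₀ , refl , h
  front-bound b w r h with m≤n⇒∃[o]m+o≡n (subst (_< r) (*-suc m (countB w)) h)
  ... | o , refl = m * countB w + o , +-assoc (suc m) (m * countB w) o , m≤m+n (m * countB w) o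

  -- Peeling a letter consumes at least one unit of fuel.
  peel-fuel : ∀ x r₀ s k → ‖ x ‖ + r₀ + s ≤ k → r₀ + s < k
  peel-fuel a r₀ s k h = h
  peel-fuel b r₀ s k h = ≤-trans (s≤s (subst (r₀ + s ≤_) (sym (+-assoc m r₀ s)) (m≤n+m (r₀ + s) m))) h

  mutual
    exchange-transfer : ∀ k r s w → r + s < k → m * countB w ≤ r → m * countB w ≤ s →
                        Transfer r s w (exchange k r s w)
    exchange-transfer zero    r s w () hr hs
    exchange-transfer (suc k) r s w (s≤s fuel) hr hs with m * countB w <? r | m * countB w <? s
    ... | yes c<r | _     = peel-transfer k r s w fuel c<r hs
    ... | no _    | yes c<s = transfer-reverse
          (peel-transfer k s r (reverse w) (subst (_≤ k) (+-comm r s) fuel)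
             (subst (λ c → m * c < s) (sym (countB-reverse w)) c<s)
             (subst (λ c → m * c ≤ r) (sym (countB-reverse w)) hr))
    ... | no c≮r  | no c≮s  = transfer-reflect w (trans (≤-antisym (≮⇒≥ c≮r) hr) (≤-antisym hs (≮⇒≥ c≮s)))

    peel-transfer : ∀ k r s w → r + s ≤ k → m * countB w < r → m * countB w ≤ s →
                    Transfer r s w (peel k r s w)
    peel-transfer k r s [] fuel c<r hs =
      (λ sp → ⊥-elim (m+1+n≢0 r (sym (split-weight sp)))) , (λ sp → ⊥-elim (m+1+n≢0 0 (sym (split-weight sp))))
    peel-transfer k r s (x ∷ w) fuel c<r hs with front-bound x w r c<r
    ... | r₀ , refl , hr₀ =
      subst (Transfer (‖ x ‖ + r₀) s (x ∷ w)) (sym (peel-∷ k r₀ s x w))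
        (transfer-cons x (exchange-transfer k r₀ s w (peel-fuel x r₀ s k fuel) hr₀
                            (≤-trans (*-monoʳ-≤ m (countB-tail x w)) hs)))

  Γ-≡ : ∀ {r P c w w'} (e : w ≡ w') (x : (weight m w ≡ P) × (countB w ≡ c) × HasPrefixOfWeight m r w)
        (y : (weight m w' ≡ P) × (countB w' ≡ c) × HasPrefixOfWeight m r w') →
        _≡_ {A = Γ⁽ r ⁾ m P c} (w , x) (w' , y)
  Γ-≡ refl (refl , refl , h) (refl , refl , h') = cong (λ h″ → _ , refl , refl , h″) (prefix-irrelevant h h')

  Γ-bijection : ∀ {r s c} → m * c ≤ r → m * c ≤ s →
                Γ⁽ r ⁾ m (suc (r + s)) c ⤖ Γ⁽ suc r ⁾ m (suc (r + s)) c
  Γ-bijection {r} {s} {c} hr hs = ↔⇒⤖ (mk↔ₛ′ to from to∘from from∘to)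
    where
    k = suc (r + s)
    ε : List Letter → List Letter
    ε = exchange k r s
    transfer : ∀ w → countB w ≡ c → Transfer r s w (ε w)
    transfer w eC = exchange-transfer k r s w ≤-refl
      (subst (λ c′ → m * c′ ≤ r) (sym eC) hr) (subst (λ c′ → m * c′ ≤ s) (sym eC) hs)
    to : Γ⁽ r ⁾ m k c → Γ⁽ suc r ⁾ m k c
    to (w , eW , eC , h) = ε w , split-weight sp , trans (countB-exchange k r s w) eC , split⇒prefix sp
      where sp = proj₁ (transfer w eC) (prefix⇒split h (trans eW (sym (+-suc r s))))
    from : Γ⁽ suc r ⁾ m k c → Γ⁽ r ⁾ m k c
    from (w , eW , eC , h) = ε w , trans (split-weight sp) (+-suc r s) , trans (countB-exchange k r s w) eC , split⇒prefix sp
      where sp = proj₂ (transfer w eC) (prefix⇒split h eW)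
    to∘from : ∀ y → to (from y) ≡ y
    to∘from (w , _) = Γ-≡ (exchange-involutive k r s w) _ _
    from∘to : ∀ x → from (to x) ≡ x
    from∘to (w , _) = Γ-≡ (exchange-involutive k r s w) _ _

open Exchange using (Γ-bijection)

-- With s = q - 1 + mn the weight p + q + mn is p + s + 1, and m·n ≤ p, s.
theorem2p2 : (m n p q : ℕ) → m * n ≤ p → 1 ≤ q →
    Γ⁽ p ⁾ m (p + q + m * n) n ⤖ Γ⁽ suc p ⁾ m (p + q + m * n) n
theorem2p2 m n p (suc q) mn≤p _ =
  subst (λ P → Γ⁽ p ⁾ m P n ⤖ Γ⁽ suc p ⁾ m P n) (sym weight-eq)
    (Γ-bijection m mn≤p (m≤n+m (m * n) q))
  where
  weight-eq : p + suc q + m * n ≡ suc (p + (q + m * n))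
  weight-eq = trans (+-assoc p (suc q) (m * n)) (+-suc p (q + m * n))
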